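{- Let $p$ be a prime and $0\le a\le b$ integers. Every regular dessin $\mathcal{A}=(G,x,y)$ with $G\cong\mathbb{Z}_{p^a}\oplus\mathbb{Z}_{p^b}$ and $o(x)=p^b$ is isomorphic to the dessin $(G,x,y)$ with $G$ given by the presentation $$G=\langle x,y\mid x^{p^b}=y^{p^{a+c}}=[x,y]=1,\ y^{p^a}=x^{ep^{b-c}}\rangle$$ for some pair $(c,e)$ of integers with $0\le c\le b-a$ and $e\in\mathbb{Z}_{p^c}^*$; two dessins given by pairs $(c_1,e_1)$ and $(c_2,e_2)$ are isomorphic if and only if $c_1=c_2$ and $e_1\equiv e_2\pmod{p^{c_1}}$. Consequently, up to the duality swapping the black and white vertices (i.e. $(G,x,y)\mapsto(G,y,x)$), the isomorphism classes of regular dessins with automorphism group isomorphic to $\mathbb{Z}_{p^a}\oplus\mathbb{Z}_{p^b}$ are in one-to-one correspondence with the pairs $(c,e)$ satisfying $0\le c\le b-a$ and $e\in\mathbb{Z}_{p^c}^*$.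
   Context: A regular dessin is a triple $(G,x,y)$ with $G$ a finite group generated by $x,y$, whose automorphism group is identified with $G$; $(G_1,x_1,y_1)\cong(G_2,x_2,y_2)$ if $x_1\mapsto x_2$, $y_1\mapsto y_2$ extends to a group isomorphism. $o(x)$ is the order of $x$, $\mathbb{Z}_{p^c}^*$ the unit group of $\mathbb{Z}_{p^c}$. -}

module Defs where

open import Level using (Level; _⊔_; 0ℓ) renaming (suc to lsuc)
open import Data.Nat as ℕ using (ℕ; _^_; _<_; _∸_)
open import Data.Integer as ℤ using (ℤ; +_; -_; 0ℤ; 1ℤ; ∣_∣)
import Data.Integer.Properties as ℤP
import Data.Integer.Divisibility as ℤD
open import Data.Integer.Solver using (module +-*-Solver)
open import Data.Nat.Coprimality using (Coprime)
open import Data.Product using (Σ; ∃; _×_; _,_)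
open import Data.List using (List; []; _∷_)
open import Data.List.Membership.Propositional using (_∈_)
open import Relation.Binary.PropositionalEquality as Eq using (_≡_; refl; cong₂; subst)
open import Relation.Nullary using (¬_)
open import Algebra.Bundles using (Group; RawGroup)
open import Algebra.Morphism.Structures using (module GroupMorphisms)

V : Set
V = ℤ × ℤ

_⊕_ : V → V → V
(a , b) ⊕ (c , d) = (a ℤ.+ c , b ℤ.+ d)

⊖_ : V → V
⊖ (a , b) = (- a , - b)

_⊛_ : ℤ → V → V
k ⊛ (a , b) = (k ℤ.* a , k ℤ.* b)

o : V
o = (0ℤ , 0ℤ)

data InL (vs : List V) : V → Set where
  nil  : InL vs o
  step : ∀ {w v} (k : ℤ) → v ∈ vs → InL vs w → InL vs (w ⊕ (k ⊛ v))

private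
  open +-*-Solver

  neg-step : ∀ w v k → ⊖ (w ⊕ (k ⊛ v)) ≡ (⊖ w) ⊕ ((- k) ⊛ v)
  neg-step (a , b) (c , d) k =
    cong₂ _,_ (solve 3 (λ a c k → :- (a :+ k :* c) := (:- a) :+ (:- k) :* c) refl a c k)
              (solve 3 (λ a c k → :- (a :+ k :* c) := (:- a) :+ (:- k) :* c) refl b d k)

  add-step : ∀ u w v → u ⊕ (w ⊕ v) ≡ (u ⊕ w) ⊕ v
  add-step (a , b) (c , d) (e , f) =
    cong₂ _,_ (solve 3 (λ a c e → a :+ (c :+ e) := (a :+ c) :+ e) refl a c e)
              (solve 3 (λ a c e → a :+ (c :+ e) := (a :+ c) :+ e) refl b d f)

  ⊕-o : ∀ u → u ⊕ o ≡ u
  ⊕-o (a , b) = cong₂ _,_ (ℤP.+-identityʳ a) (ℤP.+-identityʳ b)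

InL-neg : ∀ {vs w} → InL vs w → InL vs (⊖ w)
InL-neg nil = nil
InL-neg (step {w} {v} k m p) = subst (InL _) (Eq.sym (neg-step w v k)) (step (- k) m (InL-neg p))

InL-add : ∀ {vs u w} → InL vs u → InL vs w → InL vs (u ⊕ w)
InL-add {u = u} p nil = subst (InL _) (Eq.sym (⊕-o u)) p
InL-add {u = u} p (step {w} {v} k m q) = subst (InL _) (Eq.sym (add-step u w (k ⊛ v))) (step k m (InL-add p q))

private
  open +-*-Solver

  e-refl : ∀ u → u ⊕ (⊖ u) ≡ o
  e-refl (a , b) = cong₂ _,_ (ℤP.+-inverseʳ a) (ℤP.+-inverseʳ b)

  e-sym : ∀ u v → ⊖ (u ⊕ (⊖ v)) ≡ v ⊕ (⊖ u)
  e-sym (a , b) (c , d) =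
    cong₂ _,_ (solve 2 (λ a c → :- (a :+ :- c) := c :+ :- a) refl a c)
              (solve 2 (λ a c → :- (a :+ :- c) := c :+ :- a) refl b d)

  e-trans : ∀ u v w → (u ⊕ (⊖ v)) ⊕ (v ⊕ (⊖ w)) ≡ u ⊕ (⊖ w)
  e-trans (a , b) (c , d) (e , f) =
    cong₂ _,_ (solve 3 (λ a c e → (a :+ :- c) :+ (c :+ :- e) := a :+ :- e) refl a c e)
              (solve 3 (λ a c e → (a :+ :- c) :+ (c :+ :- e) := a :+ :- e) refl b d f)

  e-cong : ∀ u u' v v' → (u ⊕ (⊖ u')) ⊕ (v ⊕ (⊖ v')) ≡ (u ⊕ v) ⊕ (⊖ (u' ⊕ v'))
  e-cong (a , b) (a' , b') (c , d) (c' , d') =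
    cong₂ _,_ (solve 4 (λ a a' c c' → (a :+ :- a') :+ (c :+ :- c') := (a :+ c) :+ :- (a' :+ c')) refl a a' c c')
              (solve 4 (λ a a' c c' → (a :+ :- a') :+ (c :+ :- c') := (a :+ c) :+ :- (a' :+ c')) refl b b' d d')

  e-inv : ∀ u u' → ⊖ (u ⊕ (⊖ u')) ≡ (⊖ u) ⊕ (⊖ (⊖ u'))
  e-inv (a , b) (a' , b') =
    cong₂ _,_ (solve 2 (λ a a' → :- (a :+ :- a') := (:- a) :+ :- (:- a')) refl a a')
              (solve 2 (λ a a' → :- (a :+ :- a') := (:- a) :+ :- (:- a')) refl b b')

  e-assoc : ∀ u v w → ((u ⊕ v) ⊕ w) ⊕ (⊖ (u ⊕ (v ⊕ w))) ≡ o
  e-assoc (a , b) (c , d) (e , f) =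
    cong₂ _,_ (solve 3 (λ a c e → ((a :+ c) :+ e) :+ :- (a :+ (c :+ e)) := con 0ℤ) refl a c e)
              (solve 3 (λ a c e → ((a :+ c) :+ e) :+ :- (a :+ (c :+ e)) := con 0ℤ) refl b d f)

  e-idl : ∀ u → (o ⊕ u) ⊕ (⊖ u) ≡ o
  e-idl (a , b) =
    cong₂ _,_ (solve 1 (λ a → (con 0ℤ :+ a) :+ :- a := con 0ℤ) refl a)
              (solve 1 (λ a → (con 0ℤ :+ a) :+ :- a := con 0ℤ) refl b)

  e-idr : ∀ u → (u ⊕ o) ⊕ (⊖ u) ≡ o
  e-idr (a , b) =
    cong₂ _,_ (solve 1 (λ a → (a :+ con 0ℤ) :+ :- a := con 0ℤ) refl a)
              (solve 1 (λ a → (a :+ con 0ℤ) :+ :- a := con 0ℤ) refl b)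

  e-invl : ∀ u → ((⊖ u) ⊕ u) ⊕ (⊖ o) ≡ o
  e-invl (a , b) =
    cong₂ _,_ (solve 1 (λ a → ((:- a) :+ a) :+ :- con 0ℤ := con 0ℤ) refl a)
              (solve 1 (λ a → ((:- a) :+ a) :+ :- con 0ℤ := con 0ℤ) refl b)

  e-invr : ∀ u → (u ⊕ (⊖ u)) ⊕ (⊖ o) ≡ o
  e-invr (a , b) =
    cong₂ _,_ (solve 1 (λ a → (a :+ :- a) :+ :- con 0ℤ := con 0ℤ) refl a)
              (solve 1 (λ a → (a :+ :- a) :+ :- con 0ℤ := con 0ℤ) refl b)

-- ℤ² / ⟨vs⟩ as a group (setoid equality: difference lies in the subgroup)
Lat : List V → Group 0ℓ 0ℓ
Lat vs = record
  { Carrier = V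
  ; _≈_ = λ u v → InL vs (u ⊕ (⊖ v))
  ; _∙_ = _⊕_
  ; ε = o
  ; _⁻¹ = ⊖_
  ; isGroup = record
    { isMonoid = record
      { isSemigroup = record
        { isMagma = record
          { isEquivalence = record
            { refl = λ {u} → subst (InL vs) (Eq.sym (e-refl u)) nil
            ; sym = λ {u} {v} p → subst (InL vs) (e-sym u v) (InL-neg p)
            ; trans = λ {u} {v} {w} p q → subst (InL vs) (e-trans u v w) (InL-add p q)
            }
          ; ∙-cong = λ {u} {u'} {v} {v'} p q → subst (InL vs) (e-cong u u' v v') (InL-add p q)
          }
        ; assoc = λ u v w → subst (InL vs) (Eq.sym (e-assoc u v w)) nil
        }
      ; identity = (λ u → subst (InL vs) (Eq.sym (e-idl u)) nil)
                 , (λ u → subst (InL vs) (Eq.sym (e-idr u)) nil)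
      }
    ; inverse = (λ u → subst (InL vs) (Eq.sym (e-invl u)) nil)
              , (λ u → subst (InL vs) (Eq.sym (e-invr u)) nil)
    ; ⁻¹-cong = λ {u} {u'} p → subst (InL vs) (e-inv u u') (InL-neg p)
    }
  }

Zsum : ℕ → ℕ → ℕ → Group 0ℓ 0ℓ
Zsum p a b = Lat ((+ (p ^ a) , 0ℤ) ∷ (0ℤ , + (p ^ b)) ∷ [])

-- Since [x,y]=1 the group is abelian, hence it is ℤ² (x = (1,0), y = (0,1))
-- modulo the relators  x^{p^b}, y^{p^{a+c}}, x^{-e p^{b-c}} y^{p^a}.
PresGroup : ℕ → ℕ → ℕ → ℕ → ℤ → Group 0ℓ 0ℓ
PresGroup p a b c e =
  Lat ((+ (p ^ b) , 0ℤ) ∷ (0ℤ , + (p ^ (a ℕ.+ c))) ∷ (- (e ℤ.* + (p ^ (b ∸ c))) , + (p ^ a)) ∷ [])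

record Triple (c ℓ : Level) : Set (lsuc (c ⊔ ℓ)) where
  constructor triple
  field
    group : Group c ℓ
    x y   : Group.Carrier group

Pres : ℕ → ℕ → ℕ → ℕ → ℤ → Triple 0ℓ 0ℓ
Pres p a b c e = triple (PresGroup p a b c e) (1ℤ , 0ℤ) (0ℤ , 1ℤ)

dual : ∀ {c ℓ} → Triple c ℓ → Triple c ℓ
dual (triple G x y) = triple G y x

module _ {c ℓ} (G : Group c ℓ) (x y : Group.Carrier G) where
  open Group G
  data Gen : Carrier → Set (c ⊔ ℓ) where
    gε   : Gen ε
    gx   : ∀ {g} → Gen g → Gen (x ∙ g)
    gx⁻¹ : ∀ {g} → Gen g → Gen (x ⁻¹ ∙ g)
    gy   : ∀ {g} → Gen g → Gen (y ∙ g)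
    gy⁻¹ : ∀ {g} → Gen g → Gen (y ⁻¹ ∙ g)
    gresp : ∀ {g h} → g ≈ h → Gen g → Gen h

-- a regular dessin: G is generated by x and y
IsDessin : ∀ {c ℓ} → Triple c ℓ → Set (c ⊔ ℓ)
IsDessin (triple G x y) = ∀ g → Gen G x y g

_≅G_ : ∀ {c₁ ℓ₁ c₂ ℓ₂} → Group c₁ ℓ₁ → Group c₂ ℓ₂ → Set (c₁ ⊔ ℓ₁ ⊔ c₂ ⊔ ℓ₂)
G ≅G H = Σ (Group.Carrier G → Group.Carrier H) λ f →
  GroupMorphisms.IsGroupIsomorphism (Group.rawGroup G) (Group.rawGroup H) f

_≅D_ : ∀ {c₁ ℓ₁ c₂ ℓ₂} → Triple c₁ ℓ₁ → Triple c₂ ℓ₂ → Set (c₁ ⊔ ℓ₁ ⊔ c₂ ⊔ ℓ₂)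
triple G x₁ y₁ ≅D triple H x₂ y₂ = Σ (Group.Carrier G → Group.Carrier H) λ f →
  GroupMorphisms.IsGroupIsomorphism (Group.rawGroup G) (Group.rawGroup H) f
  × Group._≈_ H (f x₁) x₂ × Group._≈_ H (f y₁) y₂

pow : ∀ {c ℓ} (G : Group c ℓ) → Group.Carrier G → ℕ → Group.Carrier G
pow G g ℕ.zero    = Group.ε G
pow G g (ℕ.suc n) = Group._∙_ G g (pow G g n)

HasOrder : ∀ {c ℓ} (G : Group c ℓ) → Group.Carrier G → ℕ → Set ℓ
HasOrder G g n = (0 < n) × Group._≈_ G (pow G g n) (Group.ε G)
  × (∀ m → 0 < m → m < n → ¬ Group._≈_ G (pow G g m) (Group.ε G))

-- e ∈ ℤ_{p^c}^*  (e an integer representative of a unit mod p^c)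
IsUnitMod : ℕ → ℤ → Set
IsUnitMod n e = Coprime ∣ e ∣ n

_≡_[mod_] : ℤ → ℤ → ℕ → Set
e₁ ≡ e₂ [mod n ] = (+ n) ℤD.∣ (e₁ ℤ.- e₂)

-- Every group in sight is a quotient ℤ²/L of ℤ² by a lattice L: ℤ_{p^a} ⊕ ℤ_{p^b} is ℤ² modulo
-- Diag = p^aℤ ⊕ p^bℤ, and the presentation group with parameters (c,e) is ℤ² modulo the relator
-- lattice Relators = ⟨(p^b,0), (0,p^{a+c}), (-e p^{b-c}, p^a)⟩, with x, y the standard basis.
module Submission where

open import Defs
open import Level using (Level)
open import Data.Nat as ℕ using (ℕ; zero; suc; _≤_; _∸_; _^_; _<_; NonZero)
import Data.Nat.Properties as ℕP
import Data.Nat.Divisibility as ℕD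
open import Data.Nat.Primality using (Prime)
import Data.Nat.Primality as Pr
open import Data.Nat.Coprimality using (Coprime)
import Data.Nat.Coprimality as Cop
import Data.Nat.GCD as GCD
open import Data.Integer as ℤ using (ℤ; +_; -[1+_]; -_; 0ℤ; 1ℤ; _+_; _*_; _-_)
import Data.Integer.Properties as ℤP
import Data.Integer.Divisibility as ℤD
open import Data.Integer.Divisibility.Signed
  using (_∣_; divides; ∣-refl; ∣-trans; ∣m∣n⇒∣m+n; ∣m∣n⇒∣m-n; ∣m⇒∣-m; ∣n⇒∣m*n; ∣m⇒∣m*n; ∣ᵤ⇒∣; ∣⇒∣ᵤ)
open import Data.Integer.Tactic.RingSolver using (solve-∀)
open import Data.Product using (Σ; ∃₂; _×_; _,_; proj₁; proj₂)
open import Data.Sum using (_⊎_; inj₁; inj₂)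
open import Data.Empty using (⊥; ⊥-elim)
open import Relation.Nullary using (¬_; yes; no)
open import Data.List using (List; []; _∷_)
open import Data.List.Membership.Propositional using (_∈_)
open import Data.List.Relation.Unary.Any using (here; there)
open import Relation.Binary.PropositionalEquality
  using (_≡_; refl; sym; trans; cong; cong₂; subst; subst₂; module ≡-Reasoning)
open import Algebra.Bundles using (Group)
open import Algebra.Morphism.Structures using (module GroupMorphisms)
import Algebra.Morphism.Construct.Composition as Comp
open import Function using (_∘_)
open import Function.Bundles using (_⇔_; mk⇔)

∣0 : ∀ {n} → n ∣ 0ℤ
∣0 = divides 0ℤ refl

InL-gen : ∀ {vs v} → v ∈ vs → InL vs v
InL-gen {v = a , b} m = subst (InL _) (cong₂ _,_ (one a) (one b)) (step 1ℤ m nil)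
  where
  one : ∀ t → 0ℤ + 1ℤ * t ≡ t
  one = solve-∀

module _ (n : ℤ) (f : V → ℤ) (f-o : f o ≡ 0ℤ)
         (f-step : ∀ w k v → f (w ⊕ (k ⊛ v)) ≡ f w + k * f v) where

  form-divisible : ∀ {vs} → (∀ {v} → v ∈ vs → n ∣ f v) → ∀ {w} → InL vs w → n ∣ f w
  form-divisible gens nil = subst (n ∣_) (sym f-o) ∣0
  form-divisible gens (step {w} {v} k m q) =
    subst (n ∣_) (sym (f-step w k v)) (∣m∣n⇒∣m+n (form-divisible gens q) (∣n⇒∣m*n k (gens m)))

Diag : ℤ → ℤ → List V
Diag P Q = (P , 0ℤ) ∷ (0ℤ , Q) ∷ []

Diag-elim : ∀ {P Q u v} → InL (Diag P Q) (u , v) → P ∣ u × Q ∣ v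
Diag-elim {P} {Q} h =
  form-divisible P proj₁ refl (λ _ _ _ → refl) first h ,
  form-divisible Q proj₂ refl (λ _ _ _ → refl) second h
  where
  first : ∀ {v} → v ∈ Diag P Q → P ∣ proj₁ v
  first (here refl)         = ∣-refl
  first (there (here refl)) = ∣0
  second : ∀ {v} → v ∈ Diag P Q → Q ∣ proj₂ v
  second (here refl)         = ∣0
  second (there (here refl)) = ∣-refl

Diag-intro : ∀ {P Q u v} → P ∣ u → Q ∣ v → InL (Diag P Q) (u , v)
Diag-intro {P} {Q} (divides s refl) (divides t refl) =
  subst (InL _) (cong₂ _,_ (fst-id s P t) (snd-id s t Q))
    (step t (there (here refl)) (step s (here refl) nil))
  where
  fst-id : ∀ s P t → (0ℤ + s * P) + t * 0ℤ ≡ s * P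
  fst-id = solve-∀
  snd-id : ∀ s t Q → (0ℤ + s * 0ℤ) + t * Q ≡ t * Q
  snd-id = solve-∀

-- The relator lattice of the presentation with parameters (c,e), written with
-- P = p^a, K = p^k, C = p^c where b = a + k + c, and Q = p^b = PKC:
--   ⟨ (Q,0), (0,PC), (-ePK, P) ⟩   (the relators x^Q, y^{PC}, x^{-ePK} y^P).
Relators : (P K C Q e : ℤ) → List V
Relators P K C Q e = (Q , 0ℤ) ∷ (0ℤ , P * C) ∷ (- (e * (P * K)) , P) ∷ []

module RelatorLattice (P K C Q : ℤ) (Q≡PKC : Q ≡ P * (K * C)) where

  P∣Q : P ∣ Q
  P∣Q = divides (K * C) (trans Q≡PKC (ℤP.*-comm P (K * C)))

  relatorForm : ℤ → V → ℤ
  relatorForm e (u , v) = u + e * K * v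

  Relators-elim : ∀ {e u v} → InL (Relators P K C Q e) (u , v) → P ∣ v × Q ∣ relatorForm e (u , v)
  Relators-elim {e} h =
    form-divisible P proj₂ refl (λ _ _ _ → refl) second h ,
    form-divisible Q (relatorForm e) (form-o e K) (λ { (a , b) k (c , d) → form-step a b k c d e K }) form h
    where
    form-o : ∀ e K → 0ℤ + e * K * 0ℤ ≡ 0ℤ
    form-o = solve-∀
    form-step : ∀ a b k c d e K → (a + k * c) + e * K * (b + k * d) ≡ (a + e * K * b) + k * (c + e * K * d)
    form-step = solve-∀
    second : ∀ {v} → v ∈ Relators P K C Q e → P ∣ proj₂ v
    second (here refl)                 = ∣0
    second (there (here refl))         = ∣m⇒∣m*n C ∣-refl
    second (there (there (here refl))) = ∣-refl
    gen₁ : ∀ Q e K → Q + e * K * 0ℤ ≡ 1ℤ * Q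
    gen₁ = solve-∀
    gen₂ : ∀ e K P C → 0ℤ + e * K * (P * C) ≡ e * (P * (K * C))
    gen₂ = solve-∀
    gen₃ : ∀ e P K → - (e * (P * K)) + e * K * P ≡ 0ℤ
    gen₃ = solve-∀
    form : ∀ {v} → v ∈ Relators P K C Q e → Q ∣ relatorForm e v
    form (here refl)                 = divides 1ℤ (gen₁ Q e K)
    form (there (here refl))         = divides e (trans (gen₂ e K P C) (cong (e *_) (sym Q≡PKC)))
    form (there (there (here refl))) = subst (Q ∣_) (sym (gen₃ e P K)) ∣0

  -- (u,v) = s·(Q,0) + q·(-ePK, P)  where  v = qP  and  u + eKv = sQ.
  Relators-intro : ∀ {e u v} → P ∣ v → Q ∣ relatorForm e (u , v) → InL (Relators P K C Q e) (u , v)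
  Relators-intro {e} {u} (divides q refl) (divides s eq) =
    subst (InL _) (cong₂ _,_ fst-eq (snd-id s q P))
      (step q (there (there (here refl))) (step s (here refl) nil))
    where
    snd-id : ∀ s q P → (0ℤ + s * 0ℤ) + q * P ≡ q * P
    snd-id = solve-∀
    fst-id : ∀ u e K q P → (0ℤ + (u + e * K * (q * P))) + q * (- (e * (P * K))) ≡ u
    fst-id = solve-∀
    fst-eq : (0ℤ + s * Q) + q * (- (e * (P * K))) ≡ u
    fst-eq = trans (cong (λ t → (0ℤ + t) + q * (- (e * (P * K)))) (sym eq)) (fst-id u e K q P)

  Relators-fst : ∀ {e u v} → InL (Relators P K C Q e) (u , v) → P ∣ u
  Relators-fst {e} {u} {v} h with Relators-elim {e} h
  ... | P∣v , Q∣form = subst (P ∣_) (cancel u e K v)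
          (∣m∣n⇒∣m-n (∣-trans P∣Q Q∣form) (∣n⇒∣m*n (e * K) P∣v))
    where
    cancel : ∀ u e K v → (u + e * K * v) - e * K * v ≡ u
    cancel = solve-∀

  Relators-mod : ∀ {e e' w} → C ∣ e - e' → InL (Relators P K C Q e) w → InL (Relators P K C Q e') w
  Relators-mod {e} {e'} {u , v} (divides m e-e'≡mC) h with Relators-elim {e} h
  ... | P∣v@(divides q refl) , Q∣form₁ =
    Relators-intro {e'} P∣v (subst (Q ∣_) (change u e e' K v) (∣m∣n⇒∣m-n Q∣form₁ Q∣diff))
    where
    change : ∀ u e e' K v → (u + e * K * v) - (e - e') * K * v ≡ u + e' * K * v
    change = solve-∀
    regroup : ∀ m C K q P → m * C * K * (q * P) ≡ (m * q) * (P * (K * C))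
    regroup = solve-∀
    Q∣diff : Q ∣ (e - e') * K * (q * P)
    Q∣diff = divides (m * q) (begin
      (e - e') * K * (q * P)  ≡⟨ cong (λ t → t * K * (q * P)) e-e'≡mC ⟩
      m * C * K * (q * P)      ≡⟨ regroup m C K q P ⟩
      (m * q) * (P * (K * C))  ≡⟨ cong ((m * q) *_) Q≡PKC ⟨
      (m * q) * Q              ∎)
      where open ≡-Reasoning

record IsLinear (f : V → V) : Set where
  field
    ⊕-homo : ∀ u w → f (u ⊕ w) ≡ f u ⊕ f w
    ⊖-homo : ∀ w → f (⊖ w) ≡ ⊖ f w
    o-homo : f o ≡ o

lin : V → V → V → V
lin (x₁ , x₂) (y₁ , y₂) (u , v) = (x₁ * u + y₁ * v , x₂ * u + y₂ * v)

lin-linear : ∀ x y → IsLinear (lin x y)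
lin-linear (x₁ , x₂) (y₁ , y₂) = record
  { ⊕-homo = λ { (u , v) (u' , v') → cong₂ _,_ (add x₁ y₁ u v u' v') (add x₂ y₂ u v u' v') }
  ; ⊖-homo = λ { (u , v) → cong₂ _,_ (neg x₁ y₁ u v) (neg x₂ y₂ u v) }
  ; o-homo = cong₂ _,_ (zero′ x₁ y₁) (zero′ x₂ y₂)
  }
  where
  add : ∀ a b u v u' v' → a * (u + u') + b * (v + v') ≡ (a * u + b * v) + (a * u' + b * v')
  add = solve-∀
  neg : ∀ a b u v → a * (- u) + b * (- v) ≡ - (a * u + b * v)
  neg = solve-∀
  zero′ : ∀ a b → a * 0ℤ + b * 0ℤ ≡ 0ℤ
  zero′ = solve-∀

ê₁ ê₂ : V
ê₁ = (1ℤ , 0ℤ)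
ê₂ = (0ℤ , 1ℤ)

lin-ê₁ : ∀ x y → lin x y ê₁ ≡ x
lin-ê₁ (x₁ , x₂) (y₁ , y₂) = cong₂ _,_ (first x₁ y₁) (first x₂ y₂)
  where
  first : ∀ a b → a * 1ℤ + b * 0ℤ ≡ a
  first = solve-∀

lin-ê₂ : ∀ x y → lin x y ê₂ ≡ y
lin-ê₂ (x₁ , x₂) (y₁ , y₂) = cong₂ _,_ (second x₁ y₁) (second x₂ y₂)
  where
  second : ∀ a b → a * 0ℤ + b * 1ℤ ≡ b
  second = solve-∀

LatticeIso : List V → List V → (V → V) → Set
LatticeIso vs ws f = GroupMorphisms.IsGroupIsomorphism (Group.rawGroup (Lat vs)) (Group.rawGroup (Lat ws)) f

module _ {vs ws : List V} {f : V → V} (f-lin : IsLinear f) where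
  open IsLinear f-lin
  private
    module L₂ = Group (Lat ws)

  linearIso : (∀ w → InL vs w → InL ws (f w)) → (∀ w → InL ws (f w) → InL vs w)
            → (∀ z → Σ V λ w → InL ws (f w ⊕ (⊖ z))) → LatticeIso vs ws f
  linearIso into back onto = record
    { isGroupMonomorphism = record
      { isGroupHomomorphism = record
        { isMonoidHomomorphism = record
          { isMagmaHomomorphism = record
            { isRelHomomorphism = record { cong = respects }
            ; homo = λ u w → L₂.reflexive (⊕-homo u w) }
          ; ε-homo = L₂.reflexive o-homo }
        ; ⁻¹-homo = λ w → L₂.reflexive (⊖-homo w) }
      ; injective = λ {u} {w} h → back (u ⊕ (⊖ w)) (subst (InL ws) (sym (difference u w)) h) }
    ; surjective = λ z → proj₁ (onto z) , λ {w} h →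
        L₂.trans {f w} {f (proj₁ (onto z))} {z} (respects h) (proj₂ (onto z)) }
    where
    difference : ∀ u w → f (u ⊕ (⊖ w)) ≡ f u ⊕ (⊖ f w)
    difference u w = trans (⊕-homo u (⊖ w)) (cong (f u ⊕_) (⊖-homo w))
    respects : ∀ {u w} → InL vs (u ⊕ (⊖ w)) → InL ws (f u ⊕ (⊖ f w))
    respects {u} {w} h = subst (InL ws) (difference u w) (into _ h)

module _ (ws : List V) (x y : V) where
  private
    module L = Group (Lat ws)
  open IsLinear (lin-linear x y)

  Represented : V → Set
  Represented g = Σ V λ w → InL ws (lin x y w ⊕ (⊖ g))

  private
    shift : ∀ d {h g} → lin x y d ≡ h → Represented g → Represented (h ⊕ g)
    shift d {h} {g} eq (w , q) = d ⊕ w ,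
      L.trans {lin x y (d ⊕ w)} {lin x y d ⊕ lin x y w} {h ⊕ g} (L.reflexive (⊕-homo d w))
        (L.∙-cong {lin x y d} {h} {lin x y w} {g} (L.reflexive eq) q)

  generated-coords : ∀ {g} → Gen (Lat ws) x y g → Represented g
  generated-coords gε         = o , L.reflexive o-homo
  generated-coords (gx p)     = shift ê₁ (lin-ê₁ x y) (generated-coords p)
  generated-coords (gx⁻¹ p)   = shift (⊖ ê₁) (trans (⊖-homo ê₁) (cong ⊖_ (lin-ê₁ x y))) (generated-coords p)
  generated-coords (gy p)     = shift ê₂ (lin-ê₂ x y) (generated-coords p)
  generated-coords (gy⁻¹ p)   = shift (⊖ ê₂) (trans (⊖-homo ê₂) (cong ⊖_ (lin-ê₂ x y))) (generated-coords p)
  generated-coords (gresp {g} {h} r p) = respect (generated-coords p)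
    where
    respect : Represented g → Represented h
    respect (w , q) = w , L.trans {lin x y w} {g} {h} q r

module _ {ℓ} (P : V → Set ℓ) (P-o : P o)
  (P-ê₁ : ∀ {w} → P w → P (ê₁ ⊕ w)) (P-ê₁⁻ : ∀ {w} → P w → P ((⊖ ê₁) ⊕ w))
  (P-ê₂ : ∀ {w} → P w → P (ê₂ ⊕ w)) (P-ê₂⁻ : ∀ {w} → P w → P ((⊖ ê₂) ⊕ w)) where

  private
    vertical : ∀ v → P (0ℤ , v)
    vertical (+ zero)      = P-o
    vertical (+ suc n)     = P-ê₂ (vertical (+ n))
    vertical -[1+ zero ]   = P-ê₂⁻ P-o
    vertical -[1+ suc n ]  = P-ê₂⁻ (vertical -[1+ n ])


  ℤ²-induction : ∀ w → P w
  ℤ²-induction (+ zero , v)       = vertical v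
  ℤ²-induction (+ suc n , v)      = subst P (cong (_ ,_) (ℤP.+-identityˡ v)) (P-ê₁ (ℤ²-induction (+ n , v)))
  ℤ²-induction (-[1+ zero ] , v)  = subst P (cong (_ ,_) (ℤP.+-identityˡ v)) (P-ê₁⁻ (vertical v))
  ℤ²-induction (-[1+ suc n ] , v) = subst P (cong (_ ,_) (ℤP.+-identityˡ v)) (P-ê₁⁻ (ℤ²-induction (-[1+ n ] , v)))

ê₁ê₂-generate : ∀ vs w → Gen (Lat vs) ê₁ ê₂ w
ê₁ê₂-generate vs = ℤ²-induction (Gen (Lat vs) ê₁ ê₂) gε gx gx⁻¹ gy gy⁻¹

module Transport {c ℓ c' ℓ'} (G : Group c ℓ) (H : Group c' ℓ') (f : Group.Carrier G → Group.Carrier H)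
  (iso : GroupMorphisms.IsGroupIsomorphism (Group.rawGroup G) (Group.rawGroup H) f) where
  private
    module G = Group G
    module H = Group H
    module I = GroupMorphisms.IsGroupIsomorphism iso
  open H using (_≈_)

  pow-homo : ∀ g n → f (pow G g n) ≈ pow H (f g) n
  pow-homo g zero    = I.ε-homo
  pow-homo g (suc n) = H.trans (I.∙-homo g (pow G g n)) (H.∙-cong H.refl (pow-homo g n))

  order-to : ∀ {g n} → HasOrder G g n → HasOrder H (f g) n
  order-to {g} {n} (n>0 , gⁿ≈ε , minimal) =
    n>0 , H.trans (H.sym (pow-homo g n)) (H.trans (I.⟦⟧-cong gⁿ≈ε) I.ε-homo) ,
    λ m m>0 m<n fgᵐ≈ε → minimal m m>0 m<n
      (I.injective (H.trans (pow-homo g m) (H.trans fgᵐ≈ε (H.sym I.ε-homo))))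

  order-from : ∀ {g n} → HasOrder H (f g) n → HasOrder G g n
  order-from {g} {n} (n>0 , fgⁿ≈ε , minimal) =
    n>0 , I.injective (H.trans (pow-homo g n) (H.trans fgⁿ≈ε (H.sym I.ε-homo))) ,
    λ m m>0 m<n gᵐ≈ε → minimal m m>0 m<n
      (H.trans (H.sym (pow-homo g m)) (H.trans (I.⟦⟧-cong gᵐ≈ε) I.ε-homo))

  generated-to : ∀ {x y g} → Gen G x y g → Gen H (f x) (f y) (f g)
  generated-to gε = gresp (H.sym I.ε-homo) gε
  generated-to (gx {g} p) = gresp (H.sym (I.∙-homo _ g)) (gx (generated-to p))
  generated-to {x} (gx⁻¹ {g} p) =
    gresp (H.sym (H.trans (I.∙-homo _ g) (H.∙-cong (I.⁻¹-homo x) H.refl))) (gx⁻¹ (generated-to p))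
  generated-to (gy {g} p) = gresp (H.sym (I.∙-homo _ g)) (gy (generated-to p))
  generated-to {y = y} (gy⁻¹ {g} p) =
    gresp (H.sym (H.trans (I.∙-homo _ g) (H.∙-cong (I.⁻¹-homo y) H.refl))) (gy⁻¹ (generated-to p))
  generated-to (gresp r p) = gresp (I.⟦⟧-cong r) (generated-to p)

  generates-to : ∀ {x y} → (∀ g → Gen G x y g) → ∀ h → Gen H (f x) (f y) h
  generates-to all h with I.surjective h
  ... | g , fg≈h = gresp (fg≈h G.refl) (generated-to (all g))

  inverse : H.Carrier → G.Carrier
  inverse h = proj₁ (I.surjective h)

  inverse-section : ∀ h → f (inverse h) ≈ h
  inverse-section h = proj₂ (I.surjective h) G.refl

  inverse-iso : GroupMorphisms.IsGroupIsomorphism (Group.rawGroup H) (Group.rawGroup G) inverse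
  inverse-iso = record
    { isGroupMonomorphism = record
      { isGroupHomomorphism = record
        { isMonoidHomomorphism = record
          { isMagmaHomomorphism = record
            { isRelHomomorphism = record
              { cong = λ {a} {b} a≈b → I.injective (H.trans (s a) (H.trans a≈b (H.sym (s b)))) }
            ; homo = λ a b → I.injective (H.trans (s (a H.∙ b))
                (H.trans (H.∙-cong (H.sym (s a)) (H.sym (s b))) (H.sym (I.∙-homo (inverse a) (inverse b))))) }
          ; ε-homo = I.injective (H.trans (s H.ε) (H.sym I.ε-homo)) }
        ; ⁻¹-homo = λ a → I.injective (H.trans (s (a H.⁻¹))
            (H.trans (H.⁻¹-cong (H.sym (s a))) (H.sym (I.⁻¹-homo (inverse a))))) }
      ; injective = λ {a} {b} r → H.trans (H.sym (s a)) (H.trans (I.⟦⟧-cong r) (s b)) }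
    ; surjective = λ g → f g , λ {z} r → I.injective (H.trans (s z) r) }
    where
    s = inverse-section

≅D-sym : ∀ {c₁ ℓ₁ c₂ ℓ₂} (T₁ : Triple c₁ ℓ₁) (T₂ : Triple c₂ ℓ₂) → T₁ ≅D T₂ → T₂ ≅D T₁
≅D-sym (triple G x₁ y₁) (triple H x₂ y₂) (f , iso , fx , fy) =
  T.inverse , T.inverse-iso ,
  I.injective (Group.trans H (T.inverse-section x₂) (Group.sym H fx)) ,
  I.injective (Group.trans H (T.inverse-section y₂) (Group.sym H fy))
  where
  module T = Transport G H f iso
  module I = GroupMorphisms.IsGroupIsomorphism iso

≅D-trans : ∀ {c₁ ℓ₁ c₂ ℓ₂ c₃ ℓ₃} (T₁ : Triple c₁ ℓ₁) (T₂ : Triple c₂ ℓ₂) (T₃ : Triple c₃ ℓ₃) →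
  T₁ ≅D T₂ → T₂ ≅D T₃ → T₁ ≅D T₃
≅D-trans (triple G _ _) (triple H _ _) (triple K _ _) (f , iso , fx , fy) (g , iso' , gx≈ , gy≈) =
  g ∘ f , Comp.isGroupIsomorphism (Group.trans K) iso iso' ,
  Group.trans K (I'.⟦⟧-cong fx) gx≈ , Group.trans K (I'.⟦⟧-cong fy) gy≈
  where module I' = GroupMorphisms.IsGroupIsomorphism iso'

pow-Lat : ∀ vs g n → pow (Lat vs) g n ≡ (+ n) ⊛ g
pow-Lat vs (a , b) zero    = sym (cong₂ _,_ (ℤP.*-zeroˡ a) (ℤP.*-zeroˡ b))
pow-Lat vs (a , b) (suc n) = trans (cong ((a , b) ⊕_) (pow-Lat vs (a , b) n)) (cong₂ _,_ (succ n a) (succ n b))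
  where
  succ : ∀ n z → z + (+ n) * z ≡ (+ suc n) * z
  succ n z = trans (cong (_+ (+ n) * z) (sym (ℤP.*-identityˡ z))) (sym (ℤP.*-distribʳ-+ z 1ℤ (+ n)))

≈o⇒InL : ∀ {vs w} → InL vs (w ⊕ (⊖ o)) → InL vs w
≈o⇒InL {w = u , v} = subst (InL _) (cong₂ _,_ (ℤP.+-identityʳ u) (ℤP.+-identityʳ v))

InL⇒≈o : ∀ {vs w} → InL vs w → InL vs (w ⊕ (⊖ o))
InL⇒≈o {w = u , v} = subst (InL _) (sym (cong₂ _,_ (ℤP.+-identityʳ u) (ℤP.+-identityʳ v)))

-- An isomorphism ℤ²/L₁ → ℤ²/L₂ fixing ê₁ and ê₂ fixes every vector, so L₁ = L₂.
module _ {vs ws : List V} {f : V → V}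
  (iso : LatticeIso vs ws f)
  (fixes-ê₁ : InL ws (f ê₁ ⊕ (⊖ ê₁))) (fixes-ê₂ : InL ws (f ê₂ ⊕ (⊖ ê₂))) where
  private
    module L₂ = Group (Lat ws)
    module I = GroupMorphisms.IsGroupIsomorphism iso

  Fixed : V → Set
  Fixed w = InL ws (f w ⊕ (⊖ w))

  fixed-⊕ : ∀ {d w} → Fixed d → Fixed w → Fixed (d ⊕ w)
  fixed-⊕ {d} {w} fd fw =
    L₂.trans {f (d ⊕ w)} {f d ⊕ f w} {d ⊕ w} (I.∙-homo d w) (L₂.∙-cong {f d} {d} {f w} {w} fd fw)

  fixed-⊖ : ∀ {d} → Fixed d → Fixed (⊖ d)
  fixed-⊖ {d} fd = L₂.trans {f (⊖ d)} {⊖ f d} {⊖ d} (I.⁻¹-homo d) (L₂.⁻¹-cong {f d} {d} fd)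

  fixes-all : ∀ w → Fixed w
  fixes-all = ℤ²-induction Fixed I.ε-homo (fixed-⊕ fixes-ê₁) (fixed-⊕ (fixed-⊖ fixes-ê₁))
                                          (fixed-⊕ fixes-ê₂) (fixed-⊕ (fixed-⊖ fixes-ê₂))

  lattice-⊆ : ∀ {w} → InL vs w → InL ws w
  lattice-⊆ {w} h = ≈o⇒InL (L₂.trans {w} {f w} {o} (L₂.sym {f w} {w} (fixes-all w))
                              (L₂.trans {f w} {f o} {o} (I.⟦⟧-cong {w} {o} (InL⇒≈o h)) I.ε-homo))

  lattice-⊇ : ∀ {w} → InL ws w → InL vs w
  lattice-⊇ {w} h = ≈o⇒InL (I.injective {w} {o} (L₂.trans {f w} {w} {f o} (fixes-all w)
                              (L₂.trans {w} {o} {f o} (InL⇒≈o h) (L₂.sym {f o} {o} I.ε-homo))))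

id-linear : IsLinear (λ w → w)
id-linear = record { ⊕-homo = λ _ _ → refl ; ⊖-homo = λ _ → refl ; o-homo = refl }

sameLatticeIso : ∀ {vs ws} → (∀ w → InL vs w → InL ws w) → (∀ w → InL ws w → InL vs w) →
  LatticeIso vs ws (λ w → w)
sameLatticeIso {ws = ws} ⊆ ⊇ = linearIso id-linear ⊆ ⊇ (λ z → z , Group.refl (Lat ws) {z})

swap : V → V
swap (u , v) = (v , u)

swap-linear : IsLinear swap
swap-linear = record { ⊕-homo = λ _ _ → refl ; ⊖-homo = λ _ → refl ; o-homo = refl }

swapIso : ∀ Q → LatticeIso (Diag Q Q) (Diag Q Q) swap
swapIso Q = linearIso swap-linear flip (λ w → flip (swap w)) (λ z → swap z , Group.refl (Lat (Diag Q Q)) {z})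
  where
  flip : ∀ w → InL (Diag Q Q) w → InL (Diag Q Q) (swap w)
  flip (u , v) h with Diag-elim h
  ... | Q∣u , Q∣v = Diag-intro Q∣v Q∣u

module NormalForm (P K C Q : ℤ) (Q≡PKC : Q ≡ P * (K * C)) (x₁ x₂ y₁ y₂ i α e : ℤ)
  (x₂-inverse : i * x₂ ≡ 1ℤ + α * Q) (y₂-value : y₂ * i ≡ e * K)
  (onto : ∀ z → Represented (Diag P Q) (x₁ , x₂) (y₁ , y₂) z) where
  open RelatorLattice P K C Q Q≡PKC
  open ≡-Reasoning

  x y : V
  x = (x₁ , x₂)
  y = (y₁ , y₂)

  y₂≡eKx₂ : Q ∣ y₂ - e * K * x₂
  y₂≡eKx₂ = divides (- (y₂ * α)) (begin
    y₂ - e * K * x₂         ≡⟨ cong (λ t → y₂ - t * x₂) (sym y₂-value) ⟩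
    y₂ - y₂ * i * x₂        ≡⟨ cong (λ t → y₂ - t) (ℤP.*-assoc y₂ i x₂) ⟩
    y₂ - y₂ * (i * x₂)      ≡⟨ cong (λ t → y₂ - y₂ * t) x₂-inverse ⟩
    y₂ - y₂ * (1ℤ + α * Q)  ≡⟨ expand y₂ α Q ⟩
    - (y₂ * α) * Q          ∎)
    where
    expand : ∀ y α Q → y - y * (1ℤ + α * Q) ≡ - (y * α) * Q
    expand = solve-∀

  form⇒snd : ∀ u v → Q ∣ u + e * K * v → Q ∣ x₂ * u + y₂ * v
  form⇒snd u v h =
    subst (Q ∣_) (split x₂ u e K v y₂) (∣m∣n⇒∣m+n (∣n⇒∣m*n x₂ h) (∣m⇒∣m*n v y₂≡eKx₂))
    where
    split : ∀ x u e K v y → x * (u + e * K * v) + (y - e * K * x) * v ≡ x * u + y * v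
    split = solve-∀

  snd⇒form : ∀ u v → Q ∣ x₂ * u + y₂ * v → Q ∣ u + e * K * v
  snd⇒form u v h = subst (Q ∣_) eq (∣m∣n⇒∣m-n (∣n⇒∣m*n i h) (∣n⇒∣m*n (α * u) ∣-refl))
    where
    regroup : ∀ i x u y v α Q → i * (x * u + y * v) - α * u * Q ≡ (i * x) * u + (y * i) * v - α * u * Q
    regroup = solve-∀
    simplify : ∀ α Q u eK v → (1ℤ + α * Q) * u + eK * v - α * u * Q ≡ u + eK * v
    simplify = solve-∀
    eq : i * (x₂ * u + y₂ * v) - α * u * Q ≡ u + e * K * v
    eq = begin
      i * (x₂ * u + y₂ * v) - α * u * Q                ≡⟨ regroup i x₂ u y₂ v α Q ⟩
      (i * x₂) * u + (y₂ * i) * v - α * u * Q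
        ≡⟨ cong₂ (λ s t → s * u + t * v - α * u * Q) x₂-inverse y₂-value ⟩
      (1ℤ + α * Q) * u + e * K * v - α * u * Q         ≡⟨ simplify α Q u (e * K) v ⟩
      u + e * K * v                                    ∎

  -- This is where generation is used: pick (u₀,v₀) with
  -- u₀x + v₀y ≡ ê₁.  Modulo P we have u ≡ -eKv and u₀ ≡ -eKv₀, so with δ = y₁ - eKx₁:
  -- δv ≡ x₁u + y₁v ≡ 0 and δv₀ ≡ x₁u₀ + y₁v₀ ≡ 1, whence v ≡ v·δv₀ ≡ 0.
  P∣snd : ∀ u v → P ∣ x₁ * u + y₁ * v → Q ∣ u + e * K * v → P ∣ v
  P∣snd u v P∣fst Q∣form with onto ê₁
  ... | (u₀ , v₀) , h₀ with Diag-elim h₀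
  ... | P∣fst₀ , Q∣snd₀ =
    subst (P ∣_) (certificate x₁ y₁ u v u₀ v₀ (e * K))
      (∣m∣n⇒∣m+n (∣m∣n⇒∣m-n (∣m∣n⇒∣m-n (∣n⇒∣m*n v₀ P∣fst) (∣n⇒∣m*n v P∣fst₀))
                             (∣n⇒∣m*n (x₁ * v₀) (∣-trans P∣Q Q∣form)))
                 (∣n⇒∣m*n (x₁ * v) (∣-trans P∣Q Q∣form₀)))
    where
    Q∣form₀ : Q ∣ u₀ + e * K * v₀
    Q∣form₀ = snd⇒form u₀ v₀ (subst (Q ∣_) (ℤP.+-identityʳ _) Q∣snd₀)
    certificate : ∀ x₁ y₁ u v u₀ v₀ eK →
      v₀ * (x₁ * u + y₁ * v) - v * (x₁ * u₀ + y₁ * v₀ + - 1ℤ)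
        - x₁ * v₀ * (u + eK * v) + x₁ * v * (u₀ + eK * v₀) ≡ v
    certificate = solve-∀

  into : ∀ w → InL (Relators P K C Q e) w → InL (Diag P Q) (lin x y w)
  into (u , v) h with Relators-elim {e} h
  ... | P∣v , Q∣form =
    Diag-intro (∣m∣n⇒∣m+n (∣n⇒∣m*n x₁ (Relators-fst {e} h)) (∣n⇒∣m*n y₁ P∣v)) (form⇒snd u v Q∣form)

  back : ∀ w → InL (Diag P Q) (lin x y w) → InL (Relators P K C Q e) w
  back (u , v) h with Diag-elim h
  ... | P∣fst , Q∣snd = Relators-intro {e} (P∣snd u v P∣fst Q∣form) Q∣form
    where
    Q∣form = snd⇒form u v Q∣snd

  dessinIso : triple (Lat (Relators P K C Q e)) ê₁ ê₂ ≅D triple (Lat (Diag P Q)) x y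
  dessinIso = lin x y , linearIso (lin-linear x y) into back onto ,
              Group.reflexive (Lat (Diag P Q)) (lin-ê₁ x y) , Group.reflexive (Lat (Diag P Q)) (lin-ê₂ x y)

InverseMod : ℕ → ℤ → Set
InverseMod n x = Σ ℤ λ i → Σ ℤ λ α → i * x ≡ 1ℤ + α * + n

inverse-ℕ : ∀ {m n} → Coprime m n → InverseMod n (+ m)
inverse-ℕ {m} {n} cp with Cop.coprime-Bézout cp
... | GCD.Bézout.+- a b eq = + a , + b , (begin
  + a * + m          ≡⟨ ℤP.pos-* a m ⟨
  + (a ℕ.* m)        ≡⟨ cong +_ eq ⟨
  1ℤ + + (b ℕ.* n)   ≡⟨ cong (λ t → 1ℤ + t) (ℤP.pos-* b n) ⟩
  1ℤ + + b * + n     ∎)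
  where open ≡-Reasoning
... | GCD.Bézout.-+ a b eq = - + a , - + b , (begin
  (- + a) * + m              ≡⟨ rearrange (+ a) (+ m) ⟩
  1ℤ - (1ℤ + + a * + m)      ≡⟨ cong (λ t → 1ℤ - (1ℤ + t)) (ℤP.pos-* a m) ⟨
  1ℤ - + (1 ℕ.+ a ℕ.* m)     ≡⟨ cong (λ t → 1ℤ - + t) eq ⟩
  1ℤ - + (b ℕ.* n)           ≡⟨ cong (λ t → 1ℤ - t) (ℤP.pos-* b n) ⟩
  1ℤ - + b * + n             ≡⟨ negate (+ b) (+ n) ⟩
  1ℤ + (- + b) * + n         ∎)
  where
  open ≡-Reasoning
  rearrange : ∀ A M → (- A) * M ≡ 1ℤ - (1ℤ + A * M)
  rearrange = solve-∀
  negate : ∀ B N → 1ℤ - B * N ≡ 1ℤ + (- B) * N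
  negate = solve-∀

inverse-ℤ : ∀ {x n} → Coprime ℤ.∣ x ∣ n → InverseMod n x
inverse-ℤ {+ m} cp = inverse-ℕ cp
inverse-ℤ { -[1+ m ]} cp with inverse-ℕ cp
... | i , α , eq = - i , α , trans (neg-neg i (+ suc m)) eq
  where
  neg-neg : ∀ i X → (- i) * (- X) ≡ i * X
  neg-neg = solve-∀

cancel-invertible : ∀ {n x t} → InverseMod n x → + n ∣ t * x → + n ∣ t
cancel-invertible {n} {x} {t} (i , α , ix≡) n∣tx =
  subst (+ n ∣_) eq (∣m∣n⇒∣m-n (∣n⇒∣m*n i n∣tx) (∣n⇒∣m*n (t * α) ∣-refl))
  where
  open ≡-Reasoning
  eq : i * (t * x) - t * α * + n ≡ t
  eq = begin
    i * (t * x) - t * α * + n        ≡⟨ regroup i t x α (+ n) ⟩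
    t * (i * x) - t * α * + n        ≡⟨ cong (λ s → t * s - t * α * + n) ix≡ ⟩
    t * (1ℤ + α * + n) - t * α * + n ≡⟨ simplify t α (+ n) ⟩
    t                                ∎
    where
    regroup : ∀ i t x α N → i * (t * x) - t * α * N ≡ t * (i * x) - t * α * N
    regroup = solve-∀
    simplify : ∀ t α N → t * (1ℤ + α * N) - t * α * N ≡ t
    simplify = solve-∀

unit-mod-1 : ∀ e → IsUnitMod 1 e
unit-mod-1 e (_ , d∣1) = ℕD.∣1⇒≡1 d∣1

cancel-factor : ∀ R .{{_ : ℤ.NonZero R}} {s t} → s * R ∣ t * R → s ∣ t
cancel-factor R {s} {t} h = ∣ᵤ⇒∣ (ℤD.*-cancelʳ-∣ R {s} {t} (∣⇒∣ᵤ h))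

module PrimePowers (p : ℕ) (p-prime : Prime p) where
  instance
    p≢0 : NonZero p
    p≢0 = Pr.prime⇒nonZero p-prime

  p≢1 : ¬ p ≡ 1
  p≢1 = ℕ.nonTrivial⇒≢1 {{Pr.prime⇒nonTrivial p-prime}}

  1<p : 1 < p
  1<p = ℕ.nonTrivial⇒n>1 p {{Pr.prime⇒nonTrivial p-prime}}

  p^≢0 : ∀ n → ℤ.NonZero (+ (p ^ n))
  p^≢0 n = ℕP.m^n≢0 p n

  pow-+ : ∀ m n → + (p ^ (m ℕ.+ n)) ≡ + (p ^ m) * + (p ^ n)
  pow-+ m n = trans (cong +_ (ℕP.^-distribˡ-+-* p m n)) (ℤP.pos-* (p ^ m) (p ^ n))

  pow-∣ : ∀ {m n} → m ≤ n → + (p ^ m) ∣ + (p ^ n)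
  pow-∣ {m} {n} m≤n = divides (+ (p ^ (n ∸ m))) (begin
    + (p ^ n)                      ≡⟨ cong (λ k → + (p ^ k)) (ℕP.m+[n∸m]≡n m≤n) ⟨
    + (p ^ (m ℕ.+ (n ∸ m)))        ≡⟨ pow-+ m (n ∸ m) ⟩
    + (p ^ m) * + (p ^ (n ∸ m))    ≡⟨ ℤP.*-comm (+ (p ^ m)) _ ⟩
    + (p ^ (n ∸ m)) * + (p ^ m)    ∎)
    where open ≡-Reasoning

  shift-∣ : ∀ b {t} → + p ∣ t → + (p ^ suc b) ∣ + (p ^ b) * t
  shift-∣ b {t} (divides s refl) = divides s (begin
    + (p ^ b) * (s * + p)   ≡⟨ reorder (+ (p ^ b)) s (+ p) ⟩
    s * (+ p * + (p ^ b))   ≡⟨ cong (s *_) (ℤP.pos-* p (p ^ b)) ⟨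
    s * + (p ^ suc b)       ∎)
    where
    open ≡-Reasoning
    reorder : ∀ B s P → B * (s * P) ≡ s * (P * B)
    reorder = solve-∀

  coprime-p : ∀ {n} → ¬ (p ℕD.∣ n) → Coprime n p
  coprime-p p∤n {d} (d∣n , d∣p) with Pr.prime⇒irreducible p-prime d∣p
  ... | inj₁ d≡1  = d≡1
  ... | inj₂ refl = ⊥-elim (p∤n d∣n)

  coprime-pow : ∀ {n} → Coprime n p → ∀ c → Coprime n (p ^ c)
  coprime-pow cp zero    (_ , d∣1)   = ℕD.∣1⇒≡1 d∣1
  coprime-pow cp (suc c) (d∣n , d∣pp) =
    coprime-pow cp c (d∣n , Cop.coprime-divisor (λ (e∣d , e∣p) → cp (ℕD.∣-trans e∣d d∣n , e∣p)) d∣pp)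

  unit-not-divisible : ∀ {c e} → IsUnitMod (p ^ suc c) e → ¬ (+ p ∣ e)
  unit-not-divisible {c} unit p∣e = p≢1 (unit (∣⇒∣ᵤ p∣e , ℕD.m∣m*n (p ^ c)))

  invertible-or-divisible : ∀ b x → InverseMod (p ^ b) x ⊎ Σ ℕ λ b' → b ≡ suc b' × + p ∣ x
  invertible-or-divisible zero x = inj₁ (1ℤ , x - 1ℤ , mod-1 x)
    where
    mod-1 : ∀ x → 1ℤ * x ≡ 1ℤ + (x - 1ℤ) * 1ℤ
    mod-1 = solve-∀
  invertible-or-divisible (suc b) x with p ℕD.∣? ℤ.∣ x ∣
  ... | yes p∣x = inj₂ (b , refl , ∣ᵤ⇒∣ p∣x)
  ... | no p∤x  = inj₁ (inverse-ℤ (coprime-pow (coprime-p p∤x) (suc b)))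

  padic-split : ∀ n t → Σ ℕ λ c → Σ ℕ λ k → Σ ℤ λ e →
    c ℕ.+ k ≡ n × t ≡ e * + (p ^ k) × IsUnitMod (p ^ c) e
  padic-split zero t = 0 , 0 , t , refl , sym (ℤP.*-identityʳ t) , unit-mod-1 t
  padic-split (suc n) t with p ℕD.∣? ℤ.∣ t ∣
  ... | no p∤t = suc n , 0 , t , ℕP.+-identityʳ (suc n) , sym (ℤP.*-identityʳ t) ,
                 coprime-pow (coprime-p p∤t) (suc n)
  ... | yes p∣t with ∣ᵤ⇒∣ {+ p} {t} p∣t
  ...   | divides t' refl with padic-split n t'
  ...     | c , k , e , c+k≡n , t'≡epᵏ , unit =
    c , suc k , e , trans (ℕP.+-suc c k) (cong suc c+k≡n) , t≡epᵏ⁺¹ , unit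
    where
    open ≡-Reasoning
    t≡epᵏ⁺¹ : t' * + p ≡ e * + (p ^ suc k)
    t≡epᵏ⁺¹ = begin
      t' * + p                 ≡⟨ cong (_* + p) t'≡epᵏ ⟩
      e * + (p ^ k) * + p      ≡⟨ ℤP.*-assoc e _ _ ⟩
      e * (+ (p ^ k) * + p)    ≡⟨ cong (e *_) (ℤP.*-comm (+ (p ^ k)) (+ p)) ⟩
      e * (+ p * + (p ^ k))    ≡⟨ cong (e *_) (ℤP.pos-* p (p ^ k)) ⟨
      e * + (p ^ suc k)        ∎

presList : ℕ → ℕ → ℕ → ℕ → ℤ → List V
presList p a b c e = (+ (p ^ b) , 0ℤ) ∷ (0ℤ , + (p ^ (a ℕ.+ c))) ∷ (- (e * + (p ^ (b ∸ c))) , + (p ^ a)) ∷ []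

module Classification (p : ℕ) (p-prime : Prime p) where
  open PrimePowers p p-prime

  module Exponents (a b c k : ℕ) (b≡ : b ≡ a ℕ.+ (k ℕ.+ c)) where
    P K C Q : ℤ
    P = + (p ^ a)
    K = + (p ^ k)
    C = + (p ^ c)
    Q = + (p ^ b)

    Q≡PKC : Q ≡ P * (K * C)
    Q≡PKC = trans (cong (λ n → + (p ^ n)) b≡) (trans (pow-+ a (k ℕ.+ c)) (cong (P *_) (pow-+ k c)))

    open RelatorLattice P K C Q Q≡PKC public

    presList≡ : ∀ e → presList p a b c e ≡ Relators P K C Q e
    presList≡ e = cong₂ _∷_ refl (cong₂ _∷_ (cong (0ℤ ,_) (pow-+ a c))
                    (cong₂ _∷_ (cong (λ t → - (e * t) , P) p^[b∸c]≡PK) refl))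
      where
      b∸c≡a+k : b ∸ c ≡ a ℕ.+ k
      b∸c≡a+k = trans (cong (_∸ c) (trans b≡ (sym (ℕP.+-assoc a k c)))) (ℕP.m+n∸n≡m (a ℕ.+ k) c)
      p^[b∸c]≡PK : + (p ^ (b ∸ c)) ≡ P * K
      p^[b∸c]≡PK = trans (cong (λ n → + (p ^ n)) b∸c≡a+k) (pow-+ a k)

    Pres≡ : ∀ e → Pres p a b c e ≡ triple (Lat (Relators P K C Q e)) ê₁ ê₂
    Pres≡ e = cong (λ L → triple (Lat L) ê₁ ê₂) (presList≡ e)

    -- If the relator y^{p^{a+c'}} of another presentation holds here, then c ≤ c'
    -- (otherwise p would divide the unit e).
    depth-bound : ∀ {c' e} → IsUnitMod (p ^ c) e → InL (Relators P K C Q e) (0ℤ , + (p ^ (a ℕ.+ c'))) → c ≤ c'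
    depth-bound {c'} {e} unit h with c ℕ.≤? c'
    ... | yes c≤c' = c≤c'
    ... | no c≰c' = ⊥-elim (unit-not-divisible {c' ℕ.+ j} {e} (subst (λ n → IsUnitMod (p ^ n) e) c≡ unit)
                      (∣-trans (divides (+ (p ^ j)) p^1+j≡) (cancel-factor R {{R≢0}} {J} {e} J*R∣e*R)))
      where
      j = c ∸ suc c'
      c≡ : c ≡ suc (c' ℕ.+ j)
      c≡ = sym (ℕP.m+[n∸m]≡n (ℕP.≰⇒> c≰c'))
      C' J R : ℤ
      C' = + (p ^ c')
      J = + (p ^ suc j)
      R = P * (K * C')
      R≢0 : ℤ.NonZero R
      R≢0 = ℤP.i*j≢0 P (K * C') {{p^≢0 a}} {{ℤP.i*j≢0 K C' {{p^≢0 k}} {{p^≢0 c'}}}}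
      p^1+j≡ : J ≡ + (p ^ j) * + p
      p^1+j≡ = trans (ℤP.pos-* p (p ^ j)) (ℤP.*-comm (+ p) _)
      C≡C'J : C ≡ C' * J
      C≡C'J = trans (cong (λ n → + (p ^ n)) (trans c≡ (sym (ℕP.+-suc c' j)))) (pow-+ c' (suc j))
      regroup-Q : ∀ P K C' J → P * (K * (C' * J)) ≡ J * (P * (K * C'))
      regroup-Q = solve-∀
      regroup-form : ∀ e K P C' → 0ℤ + e * K * (P * C') ≡ e * (P * (K * C'))
      regroup-form = solve-∀
      J*R∣e*R : J * R ∣ e * R
      J*R∣e*R = subst₂ _∣_ (trans Q≡PKC (trans (cong (λ t → P * (K * t)) C≡C'J) (regroup-Q P K C' J)))
                  (trans (cong (λ t → 0ℤ + e * K * t) (pow-+ a c')) (regroup-form e K P C'))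
                  (proj₂ (Relators-elim {e} h))

    residue-determined : ∀ {e e'} → InL (Relators P K C Q e') (- (e * (P * K)) , P) → e ≡ e' [mod p ^ c ]
    residue-determined {e} {e'} h =
      ∣⇒∣ᵤ (subst (C ∣_) (flip e e') (∣m⇒∣-m (cancel-factor (P * K) {{PK≢0}} C*PK∣[e'-e]*PK)))
      where
      PK≢0 : ℤ.NonZero (P * K)
      PK≢0 = ℤP.i*j≢0 P K {{p^≢0 a}} {{p^≢0 k}}
      flip : ∀ e e' → - (e' - e) ≡ e - e'
      flip = solve-∀
      regroup-Q : ∀ P K C → P * (K * C) ≡ C * (P * K)
      regroup-Q = solve-∀
      regroup-form : ∀ e e' P K → - (e * (P * K)) + e' * K * P ≡ (e' - e) * (P * K)
      regroup-form = solve-∀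
      C*PK∣[e'-e]*PK : C * (P * K) ∣ (e' - e) * (P * K)
      C*PK∣[e'-e]*PK = subst₂ _∣_ (trans Q≡PKC (regroup-Q P K C)) (regroup-form e e' P K)
                         (proj₂ (Relators-elim {e'} h))

  standard-split : ∀ {a b c} → a ≤ b → c ≤ b ∸ a → b ≡ a ℕ.+ ((b ∸ a ∸ c) ℕ.+ c)
  standard-split {a} a≤b c≤ = sym (trans (cong (a ℕ.+_) (ℕP.m∸n+n≡m c≤)) (ℕP.m+[n∸m]≡n a≤b))

  invertible-order : ∀ {a b x₁ x₂} → a ≤ b → InverseMod (p ^ b) x₂ → HasOrder (Zsum p a b) (x₁ , x₂) (p ^ b)
  invertible-order {a} {b} {x₁} {x₂} a≤b inverse = ℕP.m^n>0 p b , killed , minimal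
    where
    killed : InL (Diag (+ (p ^ a)) (+ (p ^ b))) (pow (Zsum p a b) (x₁ , x₂) (p ^ b) ⊕ (⊖ o))
    killed = InL⇒≈o (subst (InL _) (sym (pow-Lat _ _ (p ^ b)))
               (Diag-intro (∣-trans (pow-∣ a≤b) (∣m⇒∣m*n x₁ ∣-refl)) (∣m⇒∣m*n x₂ ∣-refl)))
    minimal : ∀ m → 0 < m → m < p ^ b →
      ¬ InL (Diag (+ (p ^ a)) (+ (p ^ b))) (pow (Zsum p a b) (x₁ , x₂) m ⊕ (⊖ o))
    minimal m m>0 m<pᵇ h with Diag-elim (subst (InL _) (pow-Lat _ _ m) (≈o⇒InL h))
    ... | _ , pᵇ∣mx₂ = ℕP.<⇒≱ m<pᵇ (ℕD.∣⇒≤ {{ℕ.>-nonZero m>0}}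
                         (∣⇒∣ᵤ (cancel-invertible {p ^ b} {x₂} {+ m} inverse pᵇ∣mx₂)))

  killed-early : ∀ {a b x₁ x₂} → + (p ^ a) ∣ + (p ^ b) * x₁ → + (p ^ suc b) ∣ + (p ^ b) * x₂ →
    ¬ HasOrder (Zsum p a (suc b)) (x₁ , x₂) (p ^ suc b)
  killed-early {b = b} d₁ d₂ (_ , _ , minimal) =
    minimal (p ^ b) (ℕP.m^n>0 p b) (ℕP.^-monoʳ-< p 1<p (ℕP.n<1+n b))
      (InL⇒≈o (subst (InL _) (sym (pow-Lat _ _ (p ^ b))) (Diag-intro d₁ d₂)))

  order-coordinate : ∀ {a b x₁ x₂} → a ≤ b → HasOrder (Zsum p a b) (x₁ , x₂) (p ^ b) →
    InverseMod (p ^ b) x₂ ⊎ (a ≡ b × InverseMod (p ^ b) x₁)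
  order-coordinate {a} {b} {x₁} {x₂} a≤b ord with invertible-or-divisible b x₂
  ... | inj₁ inverse = inj₁ inverse
  ... | inj₂ (b' , refl , p∣x₂) with a ℕ.≤? b'
  ...   | yes a≤b' =
    ⊥-elim (killed-early {a} {b'} (∣-trans (pow-∣ a≤b') (∣m⇒∣m*n x₁ ∣-refl)) (shift-∣ b' p∣x₂) ord)
  ...   | no a≰b' with ℕP.≤-antisym a≤b (ℕP.≰⇒> a≰b')
  ...     | refl with invertible-or-divisible (suc b') x₁
  ...       | inj₁ inverse = inj₂ (refl , inverse)
  ...       | inj₂ (_ , _ , p∣x₁) = ⊥-elim (killed-early {suc b'} {b'} (shift-∣ b' p∣x₁) (shift-∣ b' p∣x₂) ord)

  Classified : ∀ {ℓc ℓe} → ℕ → ℕ → Triple ℓc ℓe → Set _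
  Classified a b D = Σ ℕ λ c → Σ ℤ λ e → c ≤ b ∸ a × IsUnitMod (p ^ c) e × (D ≅D Pres p a b c e)

  -- A generating pair of ℤ_{p^a} ⊕ ℤ_{p^b} with x₂ invertible mod p^b: write y₂ x₂⁻¹ = e p^k with
  -- c + k = b - a and e a unit mod p^c; then the normal form applies.
  normal-form : ∀ {a b} x y → a ≤ b → (∀ g → Gen (Zsum p a b) x y g) → InverseMod (p ^ b) (proj₂ x) →
    Classified a b (triple (Zsum p a b) x y)
  normal-form {a} {b} (x₁ , x₂) (y₁ , y₂) a≤b gen (i , α , inverse) with padic-split (b ∸ a) (y₂ * i)
  ... | c , k , e , c+k≡ , y₂i≡ , unit = c , e , subst (c ≤_) c+k≡ (ℕP.m≤m+n c k) , unit ,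
    subst (triple (Zsum p a b) (x₁ , x₂) (y₁ , y₂) ≅D_) (sym (Pres≡ e))
      (≅D-sym (triple (Lat (Relators P K C Q e)) ê₁ ê₂) (triple (Zsum p a b) (x₁ , x₂) (y₁ , y₂)) N.dessinIso)
    where
    b≡ : b ≡ a ℕ.+ (k ℕ.+ c)
    b≡ = sym (trans (cong (a ℕ.+_) (trans (ℕP.+-comm k c) c+k≡)) (ℕP.m+[n∸m]≡n a≤b))
    open Exponents a b c k b≡
    module N = NormalForm P K C Q Q≡PKC x₁ x₂ y₁ y₂ i α e inverse y₂i≡ (λ z → generated-coords _ _ _ (gen z))

  -- When a = b the two factors may be exchanged, which swaps the roles of x₁ and x₂.
  exchange-factors : ∀ {b} x y → (∀ g → Gen (Zsum p b b) x y g) → InverseMod (p ^ b) (proj₁ x) →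
    Classified b b (triple (Zsum p b b) x y)
  exchange-factors {b} x y gen inverse =
    swap-back (normal-form (swap x) (swap y) ℕP.≤-refl (Transport.generates-to Z Z swap σ gen) inverse)
    where
    Z = Zsum p b b
    σ = swapIso (+ (p ^ b))
    swap-back : Classified b b (triple Z (swap x) (swap y)) → Classified b b (triple Z x y)
    swap-back (c , e , c≤ , unit , T) = c , e , c≤ , unit ,
      ≅D-trans (triple Z x y) (triple Z (swap x) (swap y)) (Pres p b b c e)
        (swap , σ , Group.refl Z {swap x} , Group.refl Z {swap y}) T

  generating-pair : ∀ {a b} x y → a ≤ b → (∀ g → Gen (Zsum p a b) x y g) → HasOrder (Zsum p a b) x (p ^ b) →
    Classified a b (triple (Zsum p a b) x y)
  generating-pair x y a≤b gen ord with order-coordinate a≤b ord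
  ... | inj₁ inverse         = normal-form x y a≤b gen inverse
  ... | inj₂ (refl , inverse) = exchange-factors x y gen inverse

  -- By the normal form, (u,v) ↦ (v, u + eKv) identifies it with the dessin
  -- (ℤ_{p^a} ⊕ ℤ_{p^b}, (0,1), (1,eK)), and (0,1) has order p^b.
  presentation : ∀ a b → a ≤ b → ∀ c e → c ≤ b ∸ a → IsUnitMod (p ^ c) e →
    IsDessin (Pres p a b c e) × (PresGroup p a b c e ≅G Zsum p a b)
    × HasOrder (PresGroup p a b c e) (Triple.x (Pres p a b c e)) (p ^ b)
  presentation a b a≤b c e c≤ _ =
    ê₁ê₂-generate _ ,
    subst (λ L → Lat L ≅G Zsum p a b) (sym (presList≡ e)) (f , iso) ,
    subst (λ L → HasOrder (Lat L) ê₁ (p ^ b)) (sym (presList≡ e))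
      (Transport.order-from _ _ f iso (invertible-order a≤b (1ℤ , 0ℤ , unit-coordinate (e * K) Q)))
    where
    open Exponents a b c (b ∸ a ∸ c) (standard-split a≤b c≤)
    onto : ∀ z → Represented (Diag P Q) ê₂ (1ℤ , e * K) z
    onto (z₁ , z₂) = (z₂ - e * K * z₁ , z₁) ,
      Group.reflexive (Lat (Diag P Q)) (cong₂ _,_ (first z₁ z₂ (e * K)) (second z₁ z₂ (e * K)))
      where
      first : ∀ z₁ z₂ eK → 0ℤ * (z₂ - eK * z₁) + 1ℤ * z₁ ≡ z₁
      first = solve-∀
      second : ∀ z₁ z₂ eK → 1ℤ * (z₂ - eK * z₁) + eK * z₁ ≡ z₂
      second = solve-∀
    -- the image of x is ê₂, whose second coordinate 1 is trivially invertible
    unit-coordinate : ∀ eK Q → 1ℤ * (1ℤ * 1ℤ + eK * 0ℤ) ≡ 1ℤ + 0ℤ * Q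
    unit-coordinate = solve-∀
    module N = NormalForm P K C Q Q≡PKC 0ℤ 1ℤ 1ℤ (e * K) 1ℤ 0ℤ e refl (ℤP.*-identityʳ (e * K)) onto
    f = proj₁ N.dessinIso
    iso = proj₁ (proj₂ N.dessinIso)

  existence : ∀ {ℓc ℓe} a b → a ≤ b → (D : Triple ℓc ℓe) → IsDessin D → Triple.group D ≅G Zsum p a b →
    HasOrder (Triple.group D) (Triple.x D) (p ^ b) → Classified a b D
  existence a b a≤b D@(triple G x y) gen (φ , iso) ord =
    transport-back (generating-pair (φ x) (φ y) a≤b (T.generates-to gen) (T.order-to ord))
    where
    module T = Transport G (Zsum p a b) φ iso
    Z = Zsum p a b
    transport-back : Classified a b (triple Z (φ x) (φ y)) → Classified a b D
    transport-back (c , e , c≤ , unit , T) = c , e , c≤ , unit ,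
      ≅D-trans D (triple Z (φ x) (φ y)) (Pres p a b c e) (φ , iso , Group.refl Z {φ x} , Group.refl Z {φ y}) T

  congruent-iso : ∀ {a b c e e'} → a ≤ b → c ≤ b ∸ a → e ≡ e' [mod p ^ c ] → Pres p a b c e ≅D Pres p a b c e'
  congruent-iso {a} {b} {c} {e} {e'} a≤b c≤ e≡e' =
    subst₂ _≅D_ (sym (Pres≡ e)) (sym (Pres≡ e'))
      ((λ w → w) , sameLatticeIso (λ _ → Relators-mod {e} {e'} C∣e-e') (λ _ → Relators-mod {e'} {e} C∣e'-e) ,
       Group.refl (Lat (Relators P K C Q e')) {ê₁} , Group.refl (Lat (Relators P K C Q e')) {ê₂})
    where
    open Exponents a b c (b ∸ a ∸ c) (standard-split a≤b c≤)
    C∣e-e' : C ∣ e - e'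
    C∣e-e' = ∣ᵤ⇒∣ e≡e'
    flip : ∀ e e' → - (e - e') ≡ e' - e
    flip = solve-∀
    C∣e'-e : C ∣ e' - e
    C∣e'-e = subst (C ∣_) (flip e e') (∣m⇒∣-m C∣e-e')

  depth-from-inclusion : ∀ {a b c c' e e'} → a ≤ b → c ≤ b ∸ a → IsUnitMod (p ^ c) e →
    (∀ {w} → InL (presList p a b c' e') w → InL (presList p a b c e) w) → c ≤ c'
  depth-from-inclusion {a} {b} {c} {c'} {e} {e'} a≤b c≤ unit ⊇ =
    depth-bound {c'} {e} unit (subst (λ L → InL L generator) (presList≡ e) (⊇ (InL-gen (there (here refl)))))
    where
    open Exponents a b c (b ∸ a ∸ c) (standard-split a≤b c≤)
    generator : V
    generator = (0ℤ , + (p ^ (a ℕ.+ c')))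

  residue-from-inclusion : ∀ {a b c e e'} → a ≤ b → c ≤ b ∸ a →
    (∀ {w} → InL (presList p a b c e) w → InL (presList p a b c e') w) → e ≡ e' [mod p ^ c ]
  residue-from-inclusion {a} {b} {c} {e} {e'} a≤b c≤ ⊆ =
    residue-determined {e} {e'} (subst (λ L → InL L generator) (presList≡ e')
      (⊆ (subst (λ L → InL L generator) (sym (presList≡ e)) (InL-gen (there (there (here refl)))))))
    where
    open Exponents a b c (b ∸ a ∸ c) (standard-split a≤b c≤)
    generator : V
    generator = (- (e * (P * K)) , P)

  same-lattice-parameters : ∀ {a b c₁ c₂ e₁ e₂} → a ≤ b → c₁ ≤ b ∸ a → IsUnitMod (p ^ c₁) e₁ →
    c₂ ≤ b ∸ a → IsUnitMod (p ^ c₂) e₂ →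
    (∀ {w} → InL (presList p a b c₁ e₁) w → InL (presList p a b c₂ e₂) w) →
    (∀ {w} → InL (presList p a b c₂ e₂) w → InL (presList p a b c₁ e₁) w) →
    c₁ ≡ c₂ × (e₁ ≡ e₂ [mod p ^ c₁ ])
  same-lattice-parameters {a} {b} {c₁} {c₂} {e₁} {e₂} a≤b c₁≤ u₁ c₂≤ u₂ ⊆ ⊇
    with ℕP.≤-antisym (depth-from-inclusion {a} {b} {c₁} {c₂} {e₁} {e₂} a≤b c₁≤ u₁ ⊇)
                      (depth-from-inclusion {a} {b} {c₂} {c₁} {e₂} {e₁} a≤b c₂≤ u₂ ⊆)
  ... | refl = refl , residue-from-inclusion {a} {b} {c₁} {e₁} {e₂} a≤b c₁≤ ⊆

  -- An isomorphism of presentation dessins fixes ê₁, ê₂, hence identifies their relator lattices.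
  classification : ∀ a b → a ≤ b → ∀ c₁ c₂ e₁ e₂ → c₁ ≤ b ∸ a → IsUnitMod (p ^ c₁) e₁ →
    c₂ ≤ b ∸ a → IsUnitMod (p ^ c₂) e₂ →
    (Pres p a b c₁ e₁ ≅D Pres p a b c₂ e₂) ⇔ (c₁ ≡ c₂ × (e₁ ≡ e₂ [mod p ^ c₁ ]))
  classification a b a≤b c₁ c₂ e₁ e₂ c₁≤ u₁ c₂≤ u₂ = mk⇔
    (λ (f , iso , fx , fy) → same-lattice-parameters {a} {b} {c₁} {c₂} {e₁} {e₂} a≤b c₁≤ u₁ c₂≤ u₂
       (lattice-⊆ {L₁} {L₂} {f} iso fx fy) (lattice-⊇ {L₁} {L₂} {f} iso fx fy))
    (λ { (refl , e₁≡e₂) → congruent-iso {a} {b} {c₁} {e₁} {e₂} a≤b c₁≤ e₁≡e₂ })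
    where
    L₁ = presList p a b c₁ e₁
    L₂ = presList p a b c₂ e₂

  -- Part 4 (duality): if x and y generate ℤ_{p^a} ⊕ ℤ_{p^{b+1}}, p cannot divide both x₂ and y₂,
  -- since ê₂ = u x + v y would give p ∣ 1.
  second-coordinates : ∀ {a b x₁ x₂ y₁ y₂} → (∀ g → Gen (Zsum p a (suc b)) (x₁ , x₂) (y₁ , y₂) g) →
    + p ∣ x₂ → + p ∣ y₂ → ⊥
  second-coordinates {a} {b} {x₁} {x₂} {y₁} {y₂} gen p∣x₂ p∣y₂
    with generated-coords (Diag (+ (p ^ a)) (+ (p ^ suc b))) (x₁ , x₂) (y₁ , y₂) (gen ê₂)
  ... | (u , v) , h = p≢1 (ℕD.∣1⇒≡1 (∣⇒∣ᵤ (subst (+ p ∣_) (cancel (x₂ * u + y₂ * v)) p∣difference)))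
    where
    p∣p^1+b : + p ∣ + (p ^ suc b)
    p∣p^1+b = divides (+ (p ^ b)) (trans (ℤP.pos-* p (p ^ b)) (ℤP.*-comm (+ p) _))
    p∣combination : + p ∣ x₂ * u + y₂ * v
    p∣combination = ∣m∣n⇒∣m+n (∣m⇒∣m*n u p∣x₂) (∣m⇒∣m*n v p∣y₂)
    p∣difference : + p ∣ (x₂ * u + y₂ * v) - (x₂ * u + y₂ * v + - 1ℤ)
    p∣difference = ∣m∣n⇒∣m-n p∣combination (∣-trans p∣p^1+b (proj₂ (Diag-elim h)))
    cancel : ∀ s → s - (s + - 1ℤ) ≡ 1ℤ
    cancel = solve-∀

  -- Either x₂ or y₂ is invertible mod p^b, and then x resp. y has order p^b.
  duality : ∀ {ℓc ℓe} a b → a ≤ b → (D : Triple ℓc ℓe) → IsDessin D → Triple.group D ≅G Zsum p a b →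
    HasOrder (Triple.group D) (Triple.x D) (p ^ b) ⊎ HasOrder (Triple.group (dual D)) (Triple.x (dual D)) (p ^ b)
  duality a b a≤b (triple G x y) gen (φ , iso)
    with invertible-or-divisible b (proj₂ (φ x)) | invertible-or-divisible b (proj₂ (φ y))
  ... | inj₁ inverse | _ = inj₁ (Transport.order-from G (Zsum p a b) φ iso (invertible-order a≤b inverse))
  ... | inj₂ _ | inj₁ inverse = inj₂ (Transport.order-from G (Zsum p a b) φ iso (invertible-order a≤b inverse))
  ... | inj₂ (b' , refl , p∣x₂) | inj₂ (_ , _ , p∣y₂) =
    ⊥-elim (second-coordinates {a} {b'} (Transport.generates-to G (Zsum p a (suc b')) φ iso gen) p∣x₂ p∣y₂)

theorem4p7 : ∀ {ℓc ℓe : Level} (p a b : ℕ) → Prime p → a ≤ b →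
    -- each pair (c,e) gives a regular dessin with group ≅ ℤ_{p^a} ⊕ ℤ_{p^b} and o(x) = p^b
    (∀ (c : ℕ) (e : ℤ) → c ≤ b ∸ a → IsUnitMod (p ^ c) e →
      IsDessin (Pres p a b c e)
      × (PresGroup p a b c e ≅G Zsum p a b)
      × HasOrder (PresGroup p a b c e) (Triple.x (Pres p a b c e)) (p ^ b))
    -- every regular dessin with G ≅ ℤ_{p^a} ⊕ ℤ_{p^b} and o(x) = p^b is isomorphic to one of them
    × (∀ (D : Triple ℓc ℓe) → IsDessin D → Triple.group D ≅G Zsum p a b →
      HasOrder (Triple.group D) (Triple.x D) (p ^ b) →
      ∃₂ λ (c : ℕ) (e : ℤ) → c ≤ b ∸ a × IsUnitMod (p ^ c) e × (D ≅D Pres p a b c e))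
    -- classification of the pairs
    × (∀ (c₁ c₂ : ℕ) (e₁ e₂ : ℤ) → c₁ ≤ b ∸ a → IsUnitMod (p ^ c₁) e₁ →
      c₂ ≤ b ∸ a → IsUnitMod (p ^ c₂) e₂ →
      (Pres p a b c₁ e₁ ≅D Pres p a b c₂ e₂) ⇔ (c₁ ≡ c₂ × (e₁ ≡ e₂ [mod p ^ c₁ ])))
    -- up to duality every such dessin is covered: o(x) = p^b or o(y) = p^b
    × (∀ (D : Triple ℓc ℓe) → IsDessin D → Triple.group D ≅G Zsum p a b →
      HasOrder (Triple.group D) (Triple.x D) (p ^ b)
      ⊎ HasOrder (Triple.group (dual D)) (Triple.x (dual D)) (p ^ b))
theorem4p7 p a b p-prime a≤b =
  presentation a b a≤b , existence a b a≤b , classification a b a≤b , duality a b a≤b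
  where open Classification p p-prime
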